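{- Let $r>0$ be real and $n\geq 0$ an integer. Then for every complex $y$, \[ \sum_{k=0}^{n}\binom{n}{k}w_{k}^{(r)}(y)\,r^{n-k}=(-1)^{n}w_{n}^{(r)}(-y-1), \] and for every complex $y\neq 0$, \[ \sum_{k=0}^{n}\binom{n}{k}w_{k}^{(r+1)}(y)=\frac{1}{ry}\,w_{n+1}^{(r)}(y). \]
   Context: For real $r\geq 0$ and an integer $n\geq 0$, the higher order geometric polynomial is $w_{n}^{(r)}(y)=\sum_{k=0}^{n}\left\{{n\atop k}\right\}(r)_{k}\,y^{k}$, where $\left\{{n\atop k}\right\}$ denotes the Stirling numbers of the second kind and $(x)_{k}=x(x+1)\cdots(x+k-1)$, $(x)_0=1$, is the Pochhammer symbol. Equivalently, $\sum_{n\ge0}w_n^{(r)}(y)\frac{t^n}{n!}=\bigl(1-y(e^t-1)\bigr)^{ -r}$. -}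

module Defs where

open import Data.Nat as ℕ using (ℕ; zero; suc)
open import Algebra.Bundles using (CommutativeRing)

stirling2 : ℕ → ℕ → ℕ
stirling2 zero    zero    = 1
stirling2 zero    (suc k) = 0
stirling2 (suc n) zero    = 0
stirling2 (suc n) (suc k) = suc k ℕ.* stirling2 n (suc k) ℕ.+ stirling2 n k

module RingDefs {c ℓ} (R : CommutativeRing c ℓ) where
  open CommutativeRing R

  fromℕ : ℕ → Carrier
  fromℕ zero    = 0#
  fromℕ (suc n) = 1# + fromℕ n

  pow : Carrier → ℕ → Carrier
  pow x zero    = 1#
  pow x (suc n) = x * pow x n

  -- rising factorial (x)_k = x (x+1) ... (x+k-1)
  poch : Carrier → ℕ → Carrier
  poch x zero    = 1#
  poch x (suc k) = poch x k * (x + fromℕ k)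

  sumTo : ℕ → (ℕ → Carrier) → Carrier
  sumTo zero    f = f 0
  sumTo (suc n) f = sumTo n f + f (suc n)

  w : ℕ → Carrier → Carrier → Carrier
  w n r y = sumTo n (λ k → fromℕ (stirling2 n k) * poch r k * pow y k)

{-# OPTIONS --safe #-}
-- Both sides of the first identity, as functions X n r, satisfy
--   X (n+1) r = r X n r + r y X n (r+1)
-- and agree at n = 0, so they coincide. For the left side this comes from
-- w_{n+1}^{(r)}(y) = r y Σ_k C(n,k) w_k^{(r+1)}(y) (which is also the second identity, and
-- follows from S(n+1,k+1) = Σ_j C(n,j) S(j,k) and (r)_{k+1} = r (r+1)_k) together with the
-- composition law of binomial transforms. For the right side one uses in addition the
-- contiguity relation w_n^{(r)}(z) + z Σ_k C(n,k) w_k^{(r+1)}(z) = (1+z) w_n^{(r+1)}(z),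
-- a consequence of (r+1)_{k+1} = (r)_{k+1} + (k+1)(r+1)_k; at z = -y-1 the factor 1+z is -y.
module Submission where

open import Defs
open import Data.Nat using (ℕ; suc; _∸_)
open import Data.Nat.Combinatorics using (_C_)
open import Data.Product using (_×_)
open import Algebra.Bundles using (CommutativeRing)

open import Level using (_⊔_)
open import Data.Nat as ℕ using (zero; _≤_; _<_; z≤n; s≤s)
import Data.Nat.Properties as ℕ
open import Data.Nat.Combinatorics using (k>n⇒nCk≡0; nCk+nC[k+1]≡[n+1]C[k+1])
open import Data.Product using (_,_)
import Relation.Binary.PropositionalEquality as ≡

k>n⇒stirling2[n,k]≡0 : ∀ {n k} → n < k → stirling2 n k ≡.≡ 0
k>n⇒stirling2[n,k]≡0 {zero}  {suc k} _ = ≡.refl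
k>n⇒stirling2[n,k]≡0 {suc n} {suc k} (s≤s n<k)
  rewrite k>n⇒stirling2[n,k]≡0 (ℕ.m<n⇒m<1+n n<k) | k>n⇒stirling2[n,k]≡0 n<k | ℕ.*-zeroʳ k
  = ≡.refl

module _ {c ℓ} (R : CommutativeRing c ℓ) where
  open CommutativeRing R
  open RingDefs R
  open import Relation.Binary.Reasoning.Setoid setoid
  open import Algebra.Solver.Ring.NaturalCoefficients.Default commutativeSemiring
    using (solve; _:=_; _:+_; _:*_; con)
  open import Algebra.Properties.Ring ring using (-1*x≈-x)
  open import Algebra.Properties.Group +-group using (inverseˡ-unique)

  fromℕ-+ : ∀ m n → fromℕ (m ℕ.+ n) ≈ fromℕ m + fromℕ n
  fromℕ-+ zero    n = sym (+-identityˡ _)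
  fromℕ-+ (suc m) n = trans (+-congˡ (fromℕ-+ m n)) (sym (+-assoc _ _ _))

  fromℕ-* : ∀ m n → fromℕ (m ℕ.* n) ≈ fromℕ m * fromℕ n
  fromℕ-* zero    n = sym (zeroˡ _)
  fromℕ-* (suc m) n = begin
    fromℕ (n ℕ.+ m ℕ.* n)            ≈⟨ fromℕ-+ n (m ℕ.* n) ⟩
    fromℕ n + fromℕ (m ℕ.* n)        ≈⟨ +-cong (*-identityˡ _) (sym (fromℕ-* m n)) ⟨
    1# * fromℕ n + fromℕ m * fromℕ n ≈⟨ distribʳ _ _ _ ⟨
    (1# + fromℕ m) * fromℕ n         ∎

  fromℕ-C-> : ∀ {n k} → n < k → fromℕ (n C k) ≈ 0#
  fromℕ-C-> n<k = reflexive (≡.cong fromℕ (k>n⇒nCk≡0 n<k))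

  fromℕ-pascal : ∀ n k → fromℕ (suc n C suc k) ≈ fromℕ (n C k) + fromℕ (n C suc k)
  fromℕ-pascal n k = trans (reflexive (≡.cong fromℕ (≡.sym (nCk+nC[k+1]≡[n+1]C[k+1] n k))))
                           (fromℕ-+ (n C k) (n C suc k))

  pow-1# : ∀ k → pow 1# k ≈ 1#
  pow-1# zero    = refl
  pow-1# (suc k) = trans (*-identityˡ _) (pow-1# k)

  sumTo-cong≤ : ∀ n {f g : ℕ → Carrier} → (∀ {k} → k ≤ n → f k ≈ g k) → sumTo n f ≈ sumTo n g
  sumTo-cong≤ zero    f≈g = f≈g z≤n
  sumTo-cong≤ (suc n) f≈g = +-cong (sumTo-cong≤ n (λ k≤n → f≈g (ℕ.m≤n⇒m≤1+n k≤n))) (f≈g ℕ.≤-refl)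

  sumTo-cong : ∀ n {f g : ℕ → Carrier} → (∀ k → f k ≈ g k) → sumTo n f ≈ sumTo n g
  sumTo-cong n f≈g = sumTo-cong≤ n (λ {k} _ → f≈g k)

  sumTo-+ : ∀ n (f g : ℕ → Carrier) → sumTo n (λ k → f k + g k) ≈ sumTo n f + sumTo n g
  sumTo-+ zero    f g = refl
  sumTo-+ (suc n) f g = trans (+-congʳ (sumTo-+ n f g)) (+-comm-middle _ _ _ _)
    where
    +-comm-middle : ∀ a b c d → (a + b) + (c + d) ≈ (a + c) + (b + d)
    +-comm-middle = solve 4 (λ a b c d → (a :+ b) :+ (c :+ d) := (a :+ c) :+ (b :+ d)) refl

  sumTo-*ˡ : ∀ n a (f : ℕ → Carrier) → sumTo n (λ k → a * f k) ≈ a * sumTo n f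
  sumTo-*ˡ zero    a f = refl
  sumTo-*ˡ (suc n) a f = trans (+-congʳ (sumTo-*ˡ n a f)) (sym (distribˡ _ _ _))

  sumTo-*ʳ : ∀ n a (f : ℕ → Carrier) → sumTo n (λ k → f k * a) ≈ sumTo n f * a
  sumTo-*ʳ n a f = trans (sumTo-cong n (λ k → *-comm (f k) a)) (trans (sumTo-*ˡ n a f) (*-comm a _))

  sumTo-suc : ∀ n (f : ℕ → Carrier) → sumTo (suc n) f ≈ f 0 + sumTo n (λ k → f (suc k))
  sumTo-suc zero    f = refl
  sumTo-suc (suc n) f = trans (+-congʳ (sumTo-suc n f)) (+-assoc _ _ _)

  sumTo-shift : ∀ n (f : ℕ → Carrier) → f (suc n) ≈ 0# → sumTo n f ≈ f 0 + sumTo n (λ k → f (suc k))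
  sumTo-shift n f f[n+1]≈0 = trans (sym (trans (+-congˡ f[n+1]≈0) (+-identityʳ _))) (sumTo-suc n f)

  sumTo-extend : ∀ {m n} (f : ℕ → Carrier) → m ≤ n → (∀ {k} → m < k → f k ≈ 0#) → sumTo m f ≈ sumTo n f
  sumTo-extend {m} f m≤n vanish = extend (ℕ.≤⇒≤′ m≤n)
    where
    extend : ∀ {n} → m ℕ.≤′ n → sumTo m f ≈ sumTo n f
    extend ℕ.≤′-refl          = refl
    extend (ℕ.≤′-step m≤′n) =
      trans (extend m≤′n) (sym (trans (+-congˡ (vanish (s≤s (ℕ.≤′⇒≤ m≤′n)))) (+-identityʳ _)))

  sumTo-swap : ∀ m n (f : ℕ → ℕ → Carrier) →
               sumTo m (λ i → sumTo n (f i)) ≈ sumTo n (λ j → sumTo m (λ i → f i j))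
  sumTo-swap zero    n f = refl
  sumTo-swap (suc m) n f =
    trans (+-congʳ (sumTo-swap m n f)) (sym (sumTo-+ n (λ j → sumTo m (λ i → f i j)) (f (suc m))))

  sumTo-pascal : ∀ n (g : ℕ → Carrier) →
                 sumTo (suc n) (λ k → fromℕ (suc n C k) * g k)
                   ≈ sumTo (suc n) (λ k → fromℕ (n C k) * g k) + sumTo n (λ k → fromℕ (n C k) * g (suc k))
  sumTo-pascal n g = begin
    sumTo (suc n) (λ k → fromℕ (suc n C k) * g k)
      ≈⟨ sumTo-suc n _ ⟩
    g₀ + sumTo n (λ k → fromℕ (suc n C suc k) * g (suc k))
      ≈⟨ +-congˡ (sumTo-cong n (λ k → trans (*-congʳ (fromℕ-pascal n k)) (distribʳ _ _ _))) ⟩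
    g₀ + sumTo n (λ k → fromℕ (n C k) * g (suc k) + fromℕ (n C suc k) * g (suc k))
      ≈⟨ +-congˡ (sumTo-+ n _ _) ⟩
    g₀ + (sumTo n (λ k → fromℕ (n C k) * g (suc k)) + sumTo n (λ k → fromℕ (n C suc k) * g (suc k)))
      ≈⟨ rearrange _ _ _ ⟩
    (g₀ + sumTo n (λ k → fromℕ (n C suc k) * g (suc k))) + sumTo n (λ k → fromℕ (n C k) * g (suc k))
      ≈⟨ +-congʳ (sumTo-suc n _) ⟨
    sumTo (suc n) (λ k → fromℕ (n C k) * g k) + sumTo n (λ k → fromℕ (n C k) * g (suc k)) ∎
    where
    g₀ : Carrier
    g₀ = fromℕ 1 * g 0
    rearrange : ∀ a b c → a + (b + c) ≈ (a + c) + b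
    rearrange = solve 3 (λ a b c → a :+ (b :+ c) := (a :+ c) :+ b) refl

  binomialSum : ℕ → Carrier → (ℕ → Carrier) → Carrier
  binomialSum n x a = sumTo n (λ k → fromℕ (n C k) * a k * pow x (n ∸ k))

  binomialSum-cong≤ : ∀ n x {a b : ℕ → Carrier} → (∀ {k} → k ≤ n → a k ≈ b k) →
                      binomialSum n x a ≈ binomialSum n x b
  binomialSum-cong≤ n x a≈b = sumTo-cong≤ n (λ k≤n → *-congʳ (*-congˡ (a≈b k≤n)))

  binomialSum-cong : ∀ n x {a b : ℕ → Carrier} → (∀ k → a k ≈ b k) → binomialSum n x a ≈ binomialSum n x b
  binomialSum-cong n x a≈b = binomialSum-cong≤ n x (λ {k} _ → a≈b k)

  binomialSum-zero : ∀ x (a : ℕ → Carrier) → binomialSum 0 x a ≈ a 0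
  binomialSum-zero x a = solve 1 (λ a → (con 1 :+ con 0) :* a :* con 1 := a) refl (a 0)

  binomialSum-+ : ∀ n x (a b : ℕ → Carrier) →
                  binomialSum n x (λ k → a k + b k) ≈ binomialSum n x a + binomialSum n x b
  binomialSum-+ n x a b = trans (sumTo-cong n (λ k → spread _ _ _ _)) (sumTo-+ n _ _)
    where
    spread : ∀ c a b p → c * (a + b) * p ≈ c * a * p + c * b * p
    spread = solve 4 (λ c a b p → c :* (a :+ b) :* p := c :* a :* p :+ c :* b :* p) refl

  binomialSum-*ˡ : ∀ n x d (a : ℕ → Carrier) → binomialSum n x (λ k → d * a k) ≈ d * binomialSum n x a
  binomialSum-*ˡ n x d a = trans (sumTo-cong n (λ k → pull _ _ _ _)) (sumTo-*ˡ n d _)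
    where
    pull : ∀ c d a p → c * (d * a) * p ≈ d * (c * a * p)
    pull = solve 4 (λ c d a p → c :* (d :* a) :* p := d :* (c :* a :* p)) refl

  binomialSum-*ʳ : ∀ n x d (a : ℕ → Carrier) → binomialSum n x (λ k → a k * d) ≈ binomialSum n x a * d
  binomialSum-*ʳ n x d a = begin
    binomialSum n x (λ k → a k * d) ≈⟨ binomialSum-cong n x (λ k → *-comm (a k) d) ⟩
    binomialSum n x (λ k → d * a k) ≈⟨ binomialSum-*ˡ n x d a ⟩
    d * binomialSum n x a           ≈⟨ *-comm d _ ⟩
    binomialSum n x a * d           ∎

  binomialSum-vanishing : ∀ n x {a : ℕ → Carrier} → (∀ k → a k ≈ 0#) → binomialSum n x a ≈ 0#
  binomialSum-vanishing n x {a} a≈0 = begin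
    binomialSum n x a                  ≈⟨ binomialSum-cong n x (λ k → trans (a≈0 k) (sym (zeroˡ 0#))) ⟩
    binomialSum n x (λ _ → 0# * 0#)    ≈⟨ binomialSum-*ˡ n x 0# (λ _ → 0#) ⟩
    0# * binomialSum n x (λ _ → 0#)    ≈⟨ zeroˡ _ ⟩
    0#                                 ∎

  binomialSum-sumTo : ∀ n m x (f : ℕ → ℕ → Carrier) →
                      binomialSum n x (λ j → sumTo m (λ k → f k j)) ≈ sumTo m (λ k → binomialSum n x (f k))
  binomialSum-sumTo n m x f = begin
    binomialSum n x (λ j → sumTo m (λ k → f k j))
      ≈⟨ sumTo-cong n (λ j → trans (*-congʳ (sym (sumTo-*ˡ m _ _))) (sym (sumTo-*ʳ m _ _))) ⟩
    sumTo n (λ j → sumTo m (λ k → fromℕ (n C j) * f k j * pow x (n ∸ j)))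
      ≈⟨ sumTo-swap n m _ ⟩
    sumTo m (λ k → binomialSum n x (f k)) ∎

  binomialSum-1# : ∀ n (a : ℕ → Carrier) → binomialSum n 1# a ≈ sumTo n (λ k → fromℕ (n C k) * a k)
  binomialSum-1# n a = sumTo-cong n (λ k → trans (*-congˡ (pow-1# (n ∸ k))) (*-identityʳ _))

  binomialSum-suc : ∀ n x (a : ℕ → Carrier) →
                    binomialSum (suc n) x a ≈ x * binomialSum n x a + binomialSum n x (λ k → a (suc k))
  binomialSum-suc n x a = begin
    binomialSum (suc n) x a
      ≈⟨ sumTo-cong (suc n) (λ k → *-assoc _ _ _) ⟩
    sumTo (suc n) (λ k → fromℕ (suc n C k) * (a k * pow x (suc n ∸ k)))
      ≈⟨ sumTo-pascal n _ ⟩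
    sumTo (suc n) (λ k → fromℕ (n C k) * (a k * pow x (suc n ∸ k)))
      + sumTo n (λ k → fromℕ (n C k) * (a (suc k) * pow x (n ∸ k)))
      ≈⟨ +-cong lowered (sumTo-cong n (λ k → sym (*-assoc _ _ _))) ⟩
    x * binomialSum n x a + binomialSum n x (λ k → a (suc k)) ∎
    where
    raise : ∀ {k} → k ≤ n →
            fromℕ (n C k) * (a k * pow x (suc n ∸ k)) ≈ x * (fromℕ (n C k) * a k * pow x (n ∸ k))
    raise {k} k≤n rewrite ℕ.+-∸-assoc 1 k≤n =
      solve 4 (λ x c a p → c :* (a :* (x :* p)) := x :* (c :* a :* p)) refl x _ _ _
    lowered : sumTo (suc n) (λ k → fromℕ (n C k) * (a k * pow x (suc n ∸ k))) ≈ x * binomialSum n x a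
    lowered = begin
      sumTo n (λ k → fromℕ (n C k) * (a k * pow x (suc n ∸ k))) + fromℕ (n C suc n) * _
        ≈⟨ +-congˡ (trans (*-congʳ (fromℕ-C-> {n} ℕ.≤-refl)) (zeroˡ _)) ⟩
      sumTo n (λ k → fromℕ (n C k) * (a k * pow x (suc n ∸ k))) + 0#
        ≈⟨ +-identityʳ _ ⟩
      sumTo n (λ k → fromℕ (n C k) * (a k * pow x (suc n ∸ k)))
        ≈⟨ sumTo-cong≤ n raise ⟩
      sumTo n (λ k → x * (fromℕ (n C k) * a k * pow x (n ∸ k)))
        ≈⟨ sumTo-*ˡ n x _ ⟩
      x * binomialSum n x a ∎

  -- Umbrally, binomialSum n x a is (E + x)ⁿ, and (E + x + y)ⁿ = Σ C(n,k) xⁿ⁻ᵏ (E + y)ᵏ.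
  binomialSum-∘ : ∀ n x y (a : ℕ → Carrier) →
                  binomialSum n x (λ k → binomialSum k y a) ≈ binomialSum n (x + y) a
  binomialSum-∘ zero    x y a =
    trans (binomialSum-zero x (λ k → binomialSum k y a)) (trans (binomialSum-zero y a) (sym (binomialSum-zero (x + y) a)))
  binomialSum-∘ (suc n) x y a = begin
    binomialSum (suc n) x (λ k → binomialSum k y a)
      ≈⟨ binomialSum-suc n x _ ⟩
    x * binomialSum n x (λ k → binomialSum k y a) + binomialSum n x (λ k → binomialSum (suc k) y a)
      ≈⟨ +-cong (*-congˡ (binomialSum-∘ n x y a)) (binomialSum-cong n x (λ k → binomialSum-suc k y a)) ⟩
    x * S + binomialSum n x (λ k → y * binomialSum k y a + binomialSum k y a₊)
      ≈⟨ +-congˡ (binomialSum-+ n x _ _) ⟩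
    x * S + (binomialSum n x (λ k → y * binomialSum k y a) + binomialSum n x (λ k → binomialSum k y a₊))
      ≈⟨ +-congˡ (+-cong (trans (binomialSum-*ˡ n x y _) (*-congˡ (binomialSum-∘ n x y a)))
                         (binomialSum-∘ n x y a₊)) ⟩
    x * S + (y * S + binomialSum n (x + y) a₊)
      ≈⟨ collect x y S _ ⟩
    (x + y) * S + binomialSum n (x + y) a₊
      ≈⟨ binomialSum-suc n (x + y) a ⟨
    binomialSum (suc n) (x + y) a ∎
    where
    S : Carrier
    S = binomialSum n (x + y) a
    a₊ : ℕ → Carrier
    a₊ k = a (suc k)
    collect : ∀ x y s t → x * s + (y * s + t) ≈ (x + y) * s + t
    collect = solve 4 (λ x y s t → x :* s :+ (y :* s :+ t) := (x :+ y) :* s :+ t) refl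

  𝕊 : ℕ → ℕ → Carrier
  𝕊 n k = fromℕ (stirling2 n k)

  𝕊-suc-suc : ∀ n k → 𝕊 (suc n) (suc k) ≈ fromℕ (suc k) * 𝕊 n (suc k) + 𝕊 n k
  𝕊-suc-suc n k = trans (fromℕ-+ (suc k ℕ.* stirling2 n (suc k)) (stirling2 n k))
                        (+-congʳ (fromℕ-* (suc k) (stirling2 n (suc k))))

  𝕊-term-vanishes : ∀ {n k} a b → n < k → 𝕊 n k * a * b ≈ 0#
  𝕊-term-vanishes a b n<k =
    trans (*-congʳ (trans (*-congʳ (reflexive (≡.cong fromℕ (k>n⇒stirling2[n,k]≡0 n<k)))) (zeroˡ a)))
          (zeroˡ b)

  binomialSum-𝕊 : ∀ n k → binomialSum n 1# (λ j → 𝕊 j k) ≈ 𝕊 (suc n) (suc k)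
  binomialSum-𝕊 zero k = begin
    binomialSum 0 1# (λ j → 𝕊 j k)       ≈⟨ binomialSum-zero 1# (λ j → 𝕊 j k) ⟩
    𝕊 0 k                                ≈⟨ +-identityˡ _ ⟨
    0# + 𝕊 0 k                           ≈⟨ +-congʳ (zeroʳ _) ⟨
    fromℕ (suc k) * 𝕊 0 (suc k) + 𝕊 0 k  ≈⟨ 𝕊-suc-suc 0 k ⟨
    𝕊 1 (suc k)                          ∎
  binomialSum-𝕊 (suc n) zero = begin
    binomialSum (suc n) 1# (λ j → 𝕊 j 0)
      ≈⟨ binomialSum-suc n 1# _ ⟩
    1# * binomialSum n 1# (λ j → 𝕊 j 0) + binomialSum n 1# (λ j → 𝕊 (suc j) 0)
      ≈⟨ +-cong (*-congʳ (sym (+-identityʳ 1#))) (binomialSum-vanishing n 1# (λ _ → refl)) ⟩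
    fromℕ 1 * binomialSum n 1# (λ j → 𝕊 j 0) + 0#
      ≈⟨ +-congʳ (*-congˡ (binomialSum-𝕊 n 0)) ⟩
    fromℕ 1 * 𝕊 (suc n) 1 + 𝕊 (suc n) 0
      ≈⟨ 𝕊-suc-suc (suc n) 0 ⟨
    𝕊 (suc (suc n)) 1 ∎
  binomialSum-𝕊 (suc n) (suc k) = begin
    binomialSum (suc n) 1# (λ j → 𝕊 j (suc k))
      ≈⟨ binomialSum-suc n 1# _ ⟩
    1# * binomialSum n 1# (λ j → 𝕊 j (suc k)) + binomialSum n 1# (λ j → 𝕊 (suc j) (suc k))
      ≈⟨ +-congˡ (binomialSum-cong n 1# (λ j → 𝕊-suc-suc j k)) ⟩
    1# * binomialSum n 1# (λ j → 𝕊 j (suc k))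
      + binomialSum n 1# (λ j → fromℕ (suc k) * 𝕊 j (suc k) + 𝕊 j k)
      ≈⟨ +-congˡ (trans (binomialSum-+ n 1# _ _) (+-congʳ (binomialSum-*ˡ n 1# _ _))) ⟩
    1# * binomialSum n 1# (λ j → 𝕊 j (suc k))
      + (fromℕ (suc k) * binomialSum n 1# (λ j → 𝕊 j (suc k)) + binomialSum n 1# (λ j → 𝕊 j k))
      ≈⟨ +-cong (*-congˡ (binomialSum-𝕊 n (suc k)))
                (+-cong (*-congˡ (binomialSum-𝕊 n (suc k))) (binomialSum-𝕊 n k)) ⟩
    1# * 𝕊 (suc n) (suc (suc k)) + (fromℕ (suc k) * 𝕊 (suc n) (suc (suc k)) + 𝕊 (suc n) (suc k))
      ≈⟨ collect _ _ _ ⟩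
    fromℕ (suc (suc k)) * 𝕊 (suc n) (suc (suc k)) + 𝕊 (suc n) (suc k)
      ≈⟨ 𝕊-suc-suc (suc n) (suc k) ⟨
    𝕊 (suc (suc n)) (suc (suc k)) ∎
    where
    collect : ∀ s f t → 1# * s + (f * s + t) ≈ (1# + f) * s + t
    collect = solve 3 (λ s f t → con 1 :* s :+ (f :* s :+ t) := (con 1 :+ f) :* s :+ t) refl

  poch-suc : ∀ x k → poch x (suc k) ≈ x * poch (x + 1#) k
  poch-suc x zero    = solve 1 (λ x → con 1 :* (x :+ con 0) := x :* con 1) refl x
  poch-suc x (suc k) = trans (*-congʳ (poch-suc x k)) (shift x _ _)
    where
    shift : ∀ x p f → x * p * (x + (1# + f)) ≈ x * (p * ((x + 1#) + f))
    shift = solve 3 (λ x p f → x :* p :* (x :+ (con 1 :+ f)) := x :* (p :* ((x :+ con 1) :+ f))) refl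

  poch-pascal : ∀ x k → poch x (suc k) + fromℕ (suc k) * poch (x + 1#) k ≈ poch (x + 1#) (suc k)
  poch-pascal x k = trans (+-congʳ (poch-suc x k)) (collect x (fromℕ k) (poch (x + 1#) k))
    where
    collect : ∀ x f p → x * p + (1# + f) * p ≈ p * ((x + 1#) + f)
    collect = solve 3 (λ x f p → x :* p :+ (con 1 :+ f) :* p := p :* ((x :+ con 1) :+ f)) refl

  w-zero : ∀ r y → w 0 r y ≈ 1#
  w-zero r y = solve 0 ((con 1 :+ con 0) :* con 1 :* con 1 := con 1) refl

  w-extend : ∀ {j n} r y → j ≤ n → w j r y ≈ sumTo n (λ k → 𝕊 j k * poch r k * pow y k)
  w-extend r y j≤n = sumTo-extend _ j≤n (𝕊-term-vanishes _ _)

  binomialSum-w : ∀ n r y →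
                  binomialSum n 1# (λ j → w j r y) ≈ sumTo n (λ k → 𝕊 (suc n) (suc k) * poch r k * pow y k)
  binomialSum-w n r y = begin
    binomialSum n 1# (λ j → w j r y)
      ≈⟨ binomialSum-cong≤ n 1# (w-extend r y) ⟩
    binomialSum n 1# (λ j → sumTo n (λ k → 𝕊 j k * poch r k * pow y k))
      ≈⟨ binomialSum-sumTo n n 1# (λ k j → 𝕊 j k * poch r k * pow y k) ⟩
    sumTo n (λ k → binomialSum n 1# (λ j → 𝕊 j k * poch r k * pow y k))
      ≈⟨ sumTo-cong n (λ k → trans (binomialSum-*ʳ n 1# _ _) (*-congʳ (binomialSum-*ʳ n 1# _ _))) ⟩
    sumTo n (λ k → binomialSum n 1# (λ j → 𝕊 j k) * poch r k * pow y k)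
      ≈⟨ sumTo-cong n (λ k → *-congʳ (*-congʳ (binomialSum-𝕊 n k))) ⟩
    sumTo n (λ k → 𝕊 (suc n) (suc k) * poch r k * pow y k) ∎

  w-suc : ∀ n r y → w (suc n) r y ≈ (r * y) * binomialSum n 1# (λ j → w j (r + 1#) y)
  w-suc n r y = begin
    w (suc n) r y
      ≈⟨ sumTo-suc n _ ⟩
    𝕊 (suc n) 0 * 1# * 1# + sumTo n (λ k → 𝕊 (suc n) (suc k) * poch r (suc k) * pow y (suc k))
      ≈⟨ +-cong (trans (*-congʳ (zeroˡ 1#)) (zeroˡ 1#))
                (sumTo-cong n (λ k → trans (*-congʳ (*-congˡ (poch-suc r k))) (factor _ _ _ _ _))) ⟩
    0# + sumTo n (λ k → (r * y) * (𝕊 (suc n) (suc k) * poch (r + 1#) k * pow y k))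
      ≈⟨ +-identityˡ _ ⟩
    sumTo n (λ k → (r * y) * (𝕊 (suc n) (suc k) * poch (r + 1#) k * pow y k))
      ≈⟨ sumTo-*ˡ n _ _ ⟩
    (r * y) * sumTo n (λ k → 𝕊 (suc n) (suc k) * poch (r + 1#) k * pow y k)
      ≈⟨ *-congˡ (binomialSum-w n (r + 1#) y) ⟨
    (r * y) * binomialSum n 1# (λ j → w j (r + 1#) y) ∎
    where
    factor : ∀ s r p y q → s * (r * p) * (y * q) ≈ (r * y) * (s * p * q)
    factor = solve 5 (λ s r p y q → s :* (r :* p) :* (y :* q) := (r :* y) :* (s :* p :* q)) refl

  w-shiftSum : ℕ → Carrier → Carrier → Carrier
  w-shiftSum n s z = sumTo n (λ k → fromℕ (suc k) * 𝕊 n (suc k) * poch s k * pow z (suc k))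

  *-binomialSum-w : ∀ n s z → z * binomialSum n 1# (λ j → w j s z) ≈ z * w n s z + w-shiftSum n s z
  *-binomialSum-w n s z = begin
    z * binomialSum n 1# (λ j → w j s z)
      ≈⟨ *-congˡ (binomialSum-w n s z) ⟩
    z * sumTo n (λ k → 𝕊 (suc n) (suc k) * poch s k * pow z k)
      ≈⟨ sumTo-*ˡ n z _ ⟨
    sumTo n (λ k → z * (𝕊 (suc n) (suc k) * poch s k * pow z k))
      ≈⟨ sumTo-cong n (λ k → trans (*-congˡ (*-congʳ (*-congʳ (𝕊-suc-suc n k)))) (split z _ _ _ _ _)) ⟩
    sumTo n (λ k → z * (𝕊 n k * poch s k * pow z k)
                   + fromℕ (suc k) * 𝕊 n (suc k) * poch s k * pow z (suc k))
      ≈⟨ sumTo-+ n _ _ ⟩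
    sumTo n (λ k → z * (𝕊 n k * poch s k * pow z k)) + w-shiftSum n s z
      ≈⟨ +-congʳ (sumTo-*ˡ n z _) ⟩
    z * w n s z + w-shiftSum n s z ∎
    where
    split : ∀ z f a b p q → z * ((f * a + b) * p * q) ≈ z * (b * p * q) + f * a * p * (z * q)
    split = solve 6 (λ z f a b p q → z :* ((f :* a :+ b) :* p :* q)
                                    := z :* (b :* p :* q) :+ f :* a :* p :* (z :* q)) refl

  w-+-shiftSum : ∀ n r z → w n r z + w-shiftSum n (r + 1#) z ≈ w n (r + 1#) z
  w-+-shiftSum n r z = begin
    w n r z + w-shiftSum n s z
      ≈⟨ +-congʳ (sumTo-shift n _ (𝕊-term-vanishes {n} _ _ ℕ.≤-refl)) ⟩
    (𝕊 n 0 * 1# * 1# + sumTo n (λ k → 𝕊 n (suc k) * poch r (suc k) * pow z (suc k))) + w-shiftSum n s z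
      ≈⟨ +-assoc _ _ _ ⟩
    𝕊 n 0 * 1# * 1# + (sumTo n (λ k → 𝕊 n (suc k) * poch r (suc k) * pow z (suc k)) + w-shiftSum n s z)
      ≈⟨ +-congˡ (trans (sym (sumTo-+ n _ _)) (sumTo-cong n merge)) ⟩
    𝕊 n 0 * 1# * 1# + sumTo n (λ k → 𝕊 n (suc k) * poch s (suc k) * pow z (suc k))
      ≈⟨ sumTo-shift n _ (𝕊-term-vanishes {n} _ _ ℕ.≤-refl) ⟨
    w n s z ∎
    where
    s : Carrier
    s = r + 1#
    factor : ∀ c p f p′ q → c * p * q + f * c * p′ * q ≈ c * (p + f * p′) * q
    factor = solve 5 (λ c p f p′ q → c :* p :* q :+ f :* c :* p′ :* q := c :* (p :+ f :* p′) :* q) refl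
    merge : ∀ k → 𝕊 n (suc k) * poch r (suc k) * pow z (suc k)
                    + fromℕ (suc k) * 𝕊 n (suc k) * poch s k * pow z (suc k)
                  ≈ 𝕊 n (suc k) * poch s (suc k) * pow z (suc k)
    merge k = trans (factor _ _ _ _ _) (*-congʳ (*-congˡ (poch-pascal r k)))

  w-contiguous : ∀ n r z →
                 w n r z + z * binomialSum n 1# (λ j → w j (r + 1#) z) ≈ (1# + z) * w n (r + 1#) z
  w-contiguous n r z = begin
    w n r z + z * binomialSum n 1# (λ j → w j s z) ≈⟨ +-congˡ (*-binomialSum-w n s z) ⟩
    w n r z + (z * w n s z + w-shiftSum n s z)      ≈⟨ rearrange _ _ _ ⟩
    (w n r z + w-shiftSum n s z) + z * w n s z      ≈⟨ +-congʳ (w-+-shiftSum n r z) ⟩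
    w n s z + z * w n s z                           ≈⟨ collect z _ ⟩
    (1# + z) * w n s z                              ∎
    where
    s : Carrier
    s = r + 1#
    rearrange : ∀ a b c → a + (b + c) ≈ (a + c) + b
    rearrange = solve 3 (λ a b c → a :+ (b :+ c) := (a :+ c) :+ b) refl
    collect : ∀ z a → a + z * a ≈ (1# + z) * a
    collect = solve 2 (λ z a → a :+ z :* a := (con 1 :+ z) :* a) refl

  Recurrence : Carrier → (ℕ → Carrier → Carrier) → Set (c ⊔ ℓ)
  Recurrence y X = ∀ n r → X (suc n) r ≈ r * X n r + (r * y) * X n (r + 1#)

  recurrence-unique : ∀ {y} {X Y : ℕ → Carrier → Carrier} → Recurrence y X → Recurrence y Y →
                      (∀ r → X 0 r ≈ Y 0 r) → ∀ n r → X n r ≈ Y n r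
  recurrence-unique recX recY X₀≈Y₀ zero    r = X₀≈Y₀ r
  recurrence-unique {y} {X} {Y} recX recY X₀≈Y₀ (suc n) r = begin
    X (suc n) r                         ≈⟨ recX n r ⟩
    r * X n r + (r * y) * X n (r + 1#)  ≈⟨ +-cong (*-congˡ (IH r)) (*-congˡ (IH (r + 1#))) ⟩
    r * Y n r + (r * y) * Y n (r + 1#)  ≈⟨ recY n r ⟨
    Y (suc n) r                         ∎
    where
    IH : ∀ r → X n r ≈ Y n r
    IH = recurrence-unique recX recY X₀≈Y₀ n

  binomialSum-w-recurrence : ∀ y → Recurrence y (λ n r → binomialSum n r (λ k → w k r y))
  binomialSum-w-recurrence y n r = begin
    binomialSum (suc n) r (λ k → w k r y)
      ≈⟨ binomialSum-suc n r _ ⟩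
    r * binomialSum n r (λ k → w k r y) + binomialSum n r (λ k → w (suc k) r y)
      ≈⟨ +-congˡ (binomialSum-cong n r (λ k → w-suc k r y)) ⟩
    r * binomialSum n r (λ k → w k r y) + binomialSum n r (λ k → (r * y) * binomialSum k 1# (λ j → w j s y))
      ≈⟨ +-congˡ (binomialSum-*ˡ n r _ _) ⟩
    r * binomialSum n r (λ k → w k r y) + (r * y) * binomialSum n r (λ k → binomialSum k 1# (λ j → w j s y))
      ≈⟨ +-congˡ (*-congˡ (binomialSum-∘ n r 1# _)) ⟩
    r * binomialSum n r (λ k → w k r y) + (r * y) * binomialSum n s (λ k → w k s y) ∎
    where
    s : Carrier
    s = r + 1#

  1+[-y-1]≈-y : ∀ y → 1# + (- y - 1#) ≈ - y
  1+[-y-1]≈-y y = begin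
    1# + (- y + - 1#)   ≈⟨ solve 3 (λ o a b → o :+ (a :+ b) := a :+ (o :+ b)) refl 1# (- y) (- 1#) ⟩
    - y + (1# + - 1#)   ≈⟨ +-congˡ (-‿inverseʳ 1#) ⟩
    - y + 0#            ≈⟨ +-identityʳ _ ⟩
    - y                 ∎

  reflected-w-recurrence : ∀ y → Recurrence y (λ n r → pow (- 1#) n * w n r (- y - 1#))
  reflected-w-recurrence y n r = sym (begin
    r * (p * w n r z) + (r * y) * (p * W)   ≈⟨ factor r p y _ W ⟩
    r * p * (w n r z + y * W)               ≈⟨ *-congˡ w+yW≈-zQ ⟩
    r * p * - (z * Q)                       ≈⟨ *-congˡ (-1*x≈-x (z * Q)) ⟨
    r * p * (- 1# * (z * Q))                ≈⟨ regroup r p (- 1#) z Q ⟩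
    (- 1# * p) * ((r * z) * Q)              ≈⟨ *-congˡ (w-suc n r z) ⟨
    pow (- 1#) (suc n) * w (suc n) r z      ∎)
    where
    z p W Q : Carrier
    z = - y - 1#
    p = pow (- 1#) n
    W = w n (r + 1#) z
    Q = binomialSum n 1# (λ j → w j (r + 1#) z)

    factor : ∀ r p y a b → r * (p * a) + (r * y) * (p * b) ≈ r * p * (a + y * b)
    factor = solve 5 (λ r p y a b → r :* (p :* a) :+ (r :* y) :* (p :* b) := r :* p :* (a :+ y :* b)) refl
    regroup : ∀ r p m z q → r * p * (m * (z * q)) ≈ (m * p) * ((r * z) * q)
    regroup = solve 5 (λ r p m z q → r :* p :* (m :* (z :* q)) := (m :* p) :* ((r :* z) :* q)) refl
    swap : ∀ a b c → (a + b) + c ≈ (a + c) + b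
    swap = solve 3 (λ a b c → (a :+ b) :+ c := (a :+ c) :+ b) refl

    w+yW≈-zQ : w n r z + y * W ≈ - (z * Q)
    w+yW≈-zQ = inverseˡ-unique _ _ (begin
      (w n r z + y * W) + z * Q   ≈⟨ swap _ _ _ ⟩
      (w n r z + z * Q) + y * W   ≈⟨ +-congʳ (w-contiguous n r z) ⟩
      (1# + z) * W + y * W        ≈⟨ distribʳ W _ _ ⟨
      ((1# + z) + y) * W          ≈⟨ *-congʳ (trans (+-congʳ (1+[-y-1]≈-y y)) (-‿inverseˡ y)) ⟩
      0# * W                      ≈⟨ zeroˡ W ⟩
      0#                          ∎)

  binomialSum-w-reflection : ∀ r y n →
    binomialSum n r (λ k → w k r y) ≈ pow (- 1#) n * w n r (- y - 1#)
  binomialSum-w-reflection r y n =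
    recurrence-unique (binomialSum-w-recurrence y) (reflected-w-recurrence y) initial n r
    where
    initial : ∀ r → binomialSum 0 r (λ k → w k r y) ≈ 1# * w 0 r (- y - 1#)
    initial r = begin
      binomialSum 0 r (λ k → w k r y) ≈⟨ binomialSum-zero r (λ k → w k r y) ⟩
      w 0 r y                         ≈⟨ trans (w-zero r y) (sym (w-zero r (- y - 1#))) ⟩
      w 0 r (- y - 1#)                ≈⟨ *-identityˡ _ ⟨
      1# * w 0 r (- y - 1#)           ∎

  binomialSum-w-shift : ∀ r y n ι → ι * (r * y) ≈ 1# →
    sumTo n (λ k → fromℕ (n C k) * w k (r + 1#) y) ≈ ι * w (suc n) r y
  binomialSum-w-shift r y n ι ι*ry≈1 = begin
    sumTo n (λ k → fromℕ (n C k) * w k (r + 1#) y)  ≈⟨ binomialSum-1# n _ ⟨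
    Q                                                 ≈⟨ *-identityˡ Q ⟨
    1# * Q                                            ≈⟨ *-congʳ ι*ry≈1 ⟨
    ι * (r * y) * Q                                   ≈⟨ *-assoc ι _ Q ⟩
    ι * ((r * y) * Q)                                 ≈⟨ *-congˡ (w-suc n r y) ⟨
    ι * w (suc n) r y                                 ∎
    where
    Q : Carrier
    Q = binomialSum n 1# (λ j → w j (r + 1#) y)

proposition3p1 : ∀ {c ℓ} (R : CommutativeRing c ℓ) →
  let open CommutativeRing R
      open RingDefs R
  in (r y : Carrier) (n : ℕ) →
     (sumTo n (λ k → fromℕ (n C k) * w k r y * pow r (n ∸ k))
        ≈ pow (- 1#) n * w n r (- y - 1#))
     × ((ι : Carrier) → ι * (r * y) ≈ 1# →
        sumTo n (λ k → fromℕ (n C k) * w k (r + 1#) y)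
          ≈ ι * w (suc n) r y)
proposition3p1 R r y n = binomialSum-w-reflection R r y n , binomialSum-w-shift R r y n
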